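{- Assume $p_j=1$ for all $j\in[n]$. Run $\textsc{IPR}$ with $\rho=2$ (and any $\alpha\in(0,1)$, $\epsilon\in(0,1)$), and for $i\ge0$ let $b^{(i)}_{\min}$ be the minimum of $p(B)$ over all $m$ bags in the collections after $i$ iterations of the while loop. Then $b^{(i+1)}_{\min}\ge b^{(i)}_{\min}$ at each iteration $i$.
   Context: Jobs with processing times $p_j\ge0$, $p(B)=\sum_{j\in B}p_j$, $m$ machines with predicted speeds $\hat s_i>0$; $opt(\mathbf{p},\hat{\mathbf{s}})$ is the minimum makespan of scheduling the jobs with speeds $\hat{\mathbf{s}}$ (total processing time $P$ on machine $i$ takes time $P/\hat s_i$). Algorithm $\textsc{IPR}$ with inputs $\mathbf{p}$, $\hat{\mathbf{s}}$ ($\hat s_1\ge\cdots\ge\hat s_m$), $\alpha$, accuracy $\epsilon$, $\rho\ge1$: 1. Compute a partition $B_1,\dots,B_m$ with $p(B_1)\ge\cdots\ge p(B_m)$ and $\max_i p(B_i)/\hat s_i\le(1+\epsilon)\,opt(\mathbf{p},\hat{\mathbf{s}})$; set $\overline{\mathrm{OPT}}_C=\max_i p(B_i)/\hat s_i$ and $\mathcal{M}_i=\{B_i\}$. 2. While $\max\{p(B):B\in\cup_i\mathcal{M}_i,|B|\ge2\}>\rho\min\{p(B):B\in\cup_i\mathcal{M}_i\}$: let $(\mathcal{M}'_i)=\textsc{LPT-Rebalance}((\mathcal{M}_i))$; if $\max_i\sum_{B\in\mathcal{M}'_i}p(B)/\hat s_i>(1+\alpha)\overline{\mathrm{OPT}}_C$,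 return the bags in $\cup_i\mathcal{M}_i$; else set $\mathcal{M}_i\leftarrow\mathcal{M}'_i$ (one iteration). 3. Return the bags in $\cup_i\mathcal{M}_i$. $\textsc{LPT-Rebalance}$: let $B_{\min}$ be a bag of minimum processing time; let $\mathcal{M}_{\max}$ be a collection containing a bag with at least two jobs of maximum processing time among such bags; move $B_{\min}$ into $\mathcal{M}_{\max}$; let $J$ be all jobs of $\mathcal{M}_{\max}$, $\ell=|\mathcal{M}_{\max}|$; redistribute $J$ into $\ell$ new bags by LPT (jobs in nonincreasing order of processing time, each to a currently least loaded bag), replacing the bags of $\mathcal{M}_{\max}$.
   Formalization: The predicted speeds $\hat s_i$ and the parameters α and ε are rational. -}

module Defs where

open import Data.Nat using (ℕ; zero; suc) renaming (_≤_ to _≤ℕ_)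
open import Data.Fin using (Fin) renaming (_≤_ to _≤F_)
import Data.Fin as F
open import Data.Rational using (ℚ; 0ℚ; 1ℚ; _+_; _*_; _÷_; _⊔_; _≤_; _<_; Positive)
open import Data.Rational.Properties using (pos⇒nonZero)
open import Data.List using (List; []; _∷_; map; foldr; concat; concatMap; allFin; length; lookup; filter; replicate; removeAt; _[_]%=_)
open import Data.List.Membership.Propositional using (_∈_)
open import Data.List.Relation.Unary.All using (All)
open import Data.List.Relation.Unary.Linked using (Linked)
open import Data.List.Relation.Binary.Permutation.Propositional using (_↭_)
open import Data.Product using (Σ; ∃; _×_)
open import Relation.Nullary using (does)
open import Data.Bool using (if_then_else_)
open import Relation.Binary.PropositionalEquality using (_≡_)

sumℚ : List ℚ → ℚ
sumℚ = foldr _+_ 0ℚ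

-- Maximum of a list of (nonnegative) rationals; 0 for the empty list.
-- All quantities we take the maximum of are nonnegative.
maxℚ : List ℚ → ℚ
maxℚ = foldr _⊔_ 0ℚ

time : (x s : ℚ) → Positive s → ℚ
time x s ps = (x ÷ s) {{pos⇒nonZero s {{ps}}}}

-- n jobs (Fin n) with processing times p, m machines with predicted speeds ŝ.
module IPR {n m : ℕ} (p : Fin n → ℚ) (ŝ : Fin m → ℚ) (ŝpos : ∀ i → Positive (ŝ i)) where

  Bag : Set
  Bag = List (Fin n)

  pB : Bag → ℚ
  pB B = sumℚ (map p B)

  Assignment : Set
  Assignment = Fin n → Fin m

  loadσ : Assignment → Fin m → ℚ
  loadσ σ i = sumℚ (map p (filter (λ j → σ j F.≟ i) (allFin n)))

  makespanσ : Assignment → ℚ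
  makespanσ σ = maxℚ (map (λ i → time (loadσ σ i) (ŝ i) (ŝpos i)) (allFin m))

  IsOpt : ℚ → Set
  IsOpt o = (∃ λ σ → makespanσ σ ≡ o) × (∀ σ → o ≤ makespanσ σ)

  OPTC : (Fin m → Bag) → ℚ
  OPTC B = maxℚ (map (λ i → time (pB (B i)) (ŝ i) (ŝpos i)) (allFin m))

  ValidInitial : (ε : ℚ) → (Fin m → Bag) → Set
  ValidInitial ε B =
    (concatMap B (allFin m) ↭ allFin n)
    × (∀ i j → i ≤F j → pB (B j) ≤ pB (B i))
    × (∃ λ o → IsOpt o × OPTC B ≤ (1ℚ + ε) * o)

  State : Set
  State = Fin m → List Bag

  allBags : State → List Bag
  allBags st = concatMap st (allFin m)

  upd : Fin m → (List Bag → List Bag) → State → State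
  upd a f st i = if does (i F.≟ a) then f (st i) else st i

  IsMinBag : State → Bag → Set
  IsMinBag st B = B ∈ allBags st × All (λ B' → pB B ≤ pB B') (allBags st)

  IsMaxMulti : State → Bag → Set
  IsMaxMulti st B = B ∈ allBags st × 2 ≤ℕ length B
                    × All (λ B' → 2 ≤ℕ length B' → pB B' ≤ pB B) (allBags st)

  LoopCond : ℚ → State → Set
  LoopCond ρ st = ∃ λ Bmax → IsMaxMulti st Bmax ×
                  ∃ λ Bmin → IsMinBag st Bmin × ρ * pB Bmin < pB Bmax

  load : State → Fin m → ℚ
  load st i = sumℚ (map pB (st i))

  makespan : State → ℚ
  makespan st = maxℚ (map (λ i → time (load st i) (ŝ i) (ŝpos i)) (allFin m))

  -- LPT (nondeterministic in the tie-breaking)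

  LeastLoaded : (bs : List Bag) → Fin (length bs) → Set
  LeastLoaded bs k = ∀ k' → pB (lookup bs k) ≤ pB (lookup bs k')

  data LPTAssign : List (Fin n) → List Bag → List Bag → Set where
    done : ∀ {bs} → LPTAssign [] bs bs
    step : ∀ {j js bs out} (k : Fin (length bs)) → LeastLoaded bs k →
           LPTAssign js (bs [ k ]%= (j ∷_)) out → LPTAssign (j ∷ js) bs out

  LPT : List (Fin n) → ℕ → List Bag → Set
  LPT J ℓ out = Σ (List (Fin n)) λ js →
    (js ↭ J) × Linked (λ x y → p y ≤ p x) js × LPTAssign js (replicate ℓ []) out

  moveBag : (st : State) (a : Fin m) → Fin (length (st a)) → Fin m → State
  moveBag st a k c = upd c (lookup (st a) k ∷_) (upd a (λ _ → removeAt (st a) k) st)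

  record Rebalance (st st' : State) : Set where
    field
      a      : Fin m
      k      : Fin (length (st a))
      minB   : IsMinBag st (lookup (st a) k)
      c      : Fin m
      Bmax   : Bag
      Bmax∈c : Bmax ∈ st c
      maxB   : IsMaxMulti st Bmax
      new    : List Bag
      lpt    : LPT (concat (moveBag st a k c c)) (length (moveBag st a k c c)) new
      result : ∀ i → st' i ≡ upd c (λ _ → new) (moveBag st a k c) i

  Iter : (α ρ OPTc : ℚ) → State → State → Set
  Iter α ρ OPTc st st' = LoopCond ρ st × Rebalance st st' × makespan st' ≤ (1ℚ + α) * OPTc

  data Run (α ρ : ℚ) (B : Fin m → Bag) : ℕ → State → Set where
    start : Run α ρ B 0 (λ i → B i ∷ [])
    next  : ∀ {i st st'} → Run α ρ B i st → Iter α ρ (OPTC B) st st' → Run α ρ B (suc i) st'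

{-# OPTIONS --safe #-}
-- With unit jobs p(B) = |B|.  Every bag after an iteration is either a bag that was already present
-- or one of the ℓ bags that LPT builds on the chosen machine.  LPT with unit jobs keeps all its bags
-- within one job of each other, and it distributes the jobs of ℓ bags that each had at least
-- b_min jobs, i.e. at least ℓ·b_min jobs; bags that balanced with such a total all have at least
-- b_min jobs.  Neither ρ, α, ε nor the speeds play a role.
module Submission where

open import Defs
open import Data.Nat using (ℕ)
open import Data.Fin using (Fin) renaming (_≤_ to _≤F_)
open import Data.Rational using (ℚ; 0ℚ; 1ℚ; _≤_; _<_; Positive; _/_)
open import Data.Integer using (+_)
open import Relation.Binary.PropositionalEquality using (_≡_)

open import Data.Nat as ℕ using (zero; suc; z≤n; s≤s) renaming (_≤_ to _≤ℕ_; _<_ to _<ℕ_)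
import Data.Nat.Properties as ℕ
open import Data.Nat.ListAction using (sum)
import Data.Rational as ℚ
import Data.Rational.Properties as ℚ
import Data.Fin as Fin
open import Data.List using (List; []; _∷_; map; concat; allFin; length; lookup; replicate; removeAt; _[_]%=_)
open import Data.List.Properties using (length-++; length-%=; length-replicate)
open import Data.List.Membership.Propositional using (_∈_)
open import Data.List.Membership.Propositional.Properties using (∈-lookup; ∈-allFin; ∈-concat⁺′; ∈-concat⁻; ∈-map⁺)
open import Data.List.Relation.Binary.Subset.Propositional using (_⊆_)
open import Data.List.Relation.Binary.Permutation.Propositional.Properties using (↭-length)
import Data.List.Relation.Unary.All as All
open import Data.List.Relation.Unary.All.Properties using (replicate⁺)
open import Data.List.Relation.Unary.Any using (here; there; satisfied)
open import Data.List.Relation.Unary.Any.Properties using (lookup-index; map⁻)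
open import Data.Product using (∃; _,_)
open import Data.Sum using (_⊎_; inj₁; inj₂; [_,_]′)
import Data.Sum as Sum
open import Function using (_∘_)
open import Relation.Nullary using (yes; no; contradiction)
open import Relation.Binary.PropositionalEquality using (refl; sym; trans; cong; cong₂; subst; subst₂)

fromℕ : ℕ → ℚ
fromℕ zero = 0ℚ
fromℕ (suc k) = 1ℚ ℚ.+ fromℕ k

fromℕ-<-suc : ∀ k → fromℕ k < fromℕ (suc k)
fromℕ-<-suc k =
  subst (_< fromℕ (suc k)) (ℚ.+-identityˡ (fromℕ k)) (ℚ.+-monoˡ-< (fromℕ k) (ℚ.positive⁻¹ 1ℚ))

fromℕ-nonNegative : ∀ k → 0ℚ ≤ fromℕ k
fromℕ-nonNegative zero = ℚ.≤-refl
fromℕ-nonNegative (suc k) = ℚ.≤-trans (fromℕ-nonNegative k) (ℚ.<⇒≤ (fromℕ-<-suc k))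

fromℕ-mono-≤ : ∀ {a b} → a ≤ℕ b → fromℕ a ≤ fromℕ b
fromℕ-mono-≤ {b = b} z≤n = fromℕ-nonNegative b
fromℕ-mono-≤ (s≤s a≤b) = ℚ.+-monoʳ-≤ 1ℚ (fromℕ-mono-≤ a≤b)

fromℕ-cancel-≤ : ∀ {a b} → fromℕ a ≤ fromℕ b → a ≤ℕ b
fromℕ-cancel-≤ {a} {b} h with a ℕ.≤? b
... | yes a≤b = a≤b
... | no a≰b = contradiction (ℚ.<-≤-trans (ℚ.<-≤-trans (fromℕ-<-suc b) (fromℕ-mono-≤ (ℕ.≰⇒> a≰b))) h)
                             (ℚ.<-irrefl refl)

private variable A : Set

length-concat : (xss : List (List A)) → length (concat xss) ≡ sum (map length xss)
length-concat [] = refl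
length-concat (xs ∷ xss) = trans (length-++ xs) (cong (length xs ℕ.+_) (length-concat xss))

removeAt-⊆ : (xs : List A) (k : Fin (length xs)) → removeAt xs k ⊆ xs
removeAt-⊆ (x ∷ xs) Fin.zero x∈ = there x∈
removeAt-⊆ (x ∷ xs) (Fin.suc k) (here eq) = here eq
removeAt-⊆ (x ∷ xs) (Fin.suc k) (there x∈) = there (removeAt-⊆ xs k x∈)

∈-%=⁻ : ∀ {y} (xs : List A) k (f : A → A) → y ∈ xs [ k ]%= f → y ≡ f (lookup xs k) ⊎ y ∈ xs
∈-%=⁻ (x ∷ xs) Fin.zero f (here eq) = inj₁ eq
∈-%=⁻ (x ∷ xs) Fin.zero f (there y∈) = inj₂ (there y∈)
∈-%=⁻ (x ∷ xs) (Fin.suc k) f (here eq) = inj₂ (here eq)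
∈-%=⁻ (x ∷ xs) (Fin.suc k) f (there y∈) = Sum.map₂ there (∈-%=⁻ xs k f y∈)

sum-length-%=∷ : ∀ (xss : List (List A)) k (y : A) →
                 sum (map length (xss [ k ]%= (y ∷_))) ≡ suc (sum (map length xss))
sum-length-%=∷ (xs ∷ xss) Fin.zero y = refl
sum-length-%=∷ (xs ∷ xss) (Fin.suc k) y =
  trans (cong (length xs ℕ.+_) (sum-length-%=∷ xss k y)) (ℕ.+-suc (length xs) _)

module _ {A : Set} (f : A → ℕ) (t : ℕ) where

  length*≤sum-map : (xs : List A) → (∀ {x} → x ∈ xs → t ≤ℕ f x) → length xs ℕ.* t ≤ℕ sum (map f xs)
  length*≤sum-map [] _ = z≤n
  length*≤sum-map (x ∷ xs) h = ℕ.+-mono-≤ (h (here refl)) (length*≤sum-map xs (h ∘ there))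

  sum-map≤length* : (xs : List A) → (∀ {x} → x ∈ xs → f x ≤ℕ t) → sum (map f xs) ≤ℕ length xs ℕ.* t
  sum-map≤length* [] _ = z≤n
  sum-map≤length* (x ∷ xs) h = ℕ.+-mono-≤ (h (here refl)) (sum-map≤length* xs (h ∘ there))

  sum-map<length* : ∀ {y} (xs : List A) → (∀ {x} → x ∈ xs → f x ≤ℕ t) → y ∈ xs → f y <ℕ t →
                    sum (map f xs) <ℕ length xs ℕ.* t
  sum-map<length* (x ∷ xs) h (here refl) fy<t = ℕ.+-mono-<-≤ fy<t (sum-map≤length* xs (h ∘ there))
  sum-map<length* (x ∷ xs) h (there y∈) fy<t =
    ℕ.+-mono-≤-< (h (here refl)) (sum-map<length* xs (h ∘ there) y∈ fy<t)

Balanced : List (List A) → Set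
Balanced xss = ∀ {xs ys} → xs ∈ xss → ys ∈ xss → length xs ≤ℕ suc (length ys)

Balanced-replicate-[] : ∀ ℓ → Balanced (replicate ℓ ([] {A = A}))
Balanced-replicate-[] ℓ xs∈ _ rewrite All.lookup (replicate⁺ {P = _≡ []} ℓ refl) xs∈ = z≤n

Balanced-%=-shortest : ∀ {xss} k (y : A) → Balanced xss →
                       (∀ k′ → length (lookup xss k) ≤ℕ length (lookup xss k′)) →
                       Balanced (xss [ k ]%= (y ∷_))
Balanced-%=-shortest {xss = xss} k y bal shortest xs∈ ys∈
  with ∈-%=⁻ xss k (y ∷_) xs∈ | ∈-%=⁻ xss k (y ∷_) ys∈
... | inj₁ refl | inj₁ refl = ℕ.n≤1+n _
... | inj₁ refl | inj₂ ys∈′ = s≤s (shortest-≤ ys∈′)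
  where
  shortest-≤ : ∀ {ys} → ys ∈ xss → length (lookup xss k) ≤ℕ length ys
  shortest-≤ ys∈ =
    subst (λ zs → length (lookup xss k) ≤ℕ length zs) (sym (lookup-index ys∈)) (shortest _)
... | inj₂ xs∈′ | inj₁ refl = ℕ.m≤n⇒m≤1+n (bal xs∈′ (∈-lookup k))
... | inj₂ xs∈′ | inj₂ ys∈′ = bal xs∈′ ys∈′

Balanced⇒length≥ : ∀ {xss : List (List A)} t → Balanced xss →
                   length xss ℕ.* t ≤ℕ sum (map length xss) → ∀ {xs} → xs ∈ xss → t ≤ℕ length xs
Balanced⇒length≥ {xss = xss} t bal enough {xs} xs∈ with t ℕ.≤? length xs
... | yes t≤xs = t≤xs
... | no t≰xs = contradiction enough (ℕ.<⇒≱ (sum-map<length* length t xss below-t xs∈ xs<t))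
  where
  xs<t : length xs <ℕ t
  xs<t = ℕ.≰⇒> t≰xs
  below-t : ∀ {ys} → ys ∈ xss → length ys ≤ℕ t
  below-t ys∈ = ℕ.≤-trans (bal ys∈ xs∈) xs<t

module _ {n m : ℕ} (p : Fin n → ℚ) (ŝ : Fin m → ℚ) (ŝpos : ∀ i → Positive (ŝ i)) where
  open IPR p ŝ ŝpos

  LPTAssign-length : ∀ {js bs out} → LPTAssign js bs out → length out ≡ length bs
  LPTAssign-length done = refl
  LPTAssign-length (step {bs = bs} k _ rest) = trans (LPTAssign-length rest) (length-%= bs k _)

  LPTAssign-sum : ∀ {js bs out} → LPTAssign js bs out →
                  sum (map length out) ≡ length js ℕ.+ sum (map length bs)
  LPTAssign-sum done = refl
  LPTAssign-sum (step {j} {js} {bs} k _ rest) =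
    trans (LPTAssign-sum rest)
          (trans (cong (length js ℕ.+_) (sum-length-%=∷ bs k j)) (ℕ.+-suc (length js) _))

  ∈-allBags⁺ : ∀ st i → st i ⊆ allBags st
  ∈-allBags⁺ st i B∈ = ∈-concat⁺′ B∈ (∈-map⁺ st (∈-allFin i))

  ∈-allBags⁻ : ∀ st {B} → B ∈ allBags st → ∃ λ i → B ∈ st i
  ∈-allBags⁻ st B∈ = satisfied (map⁻ (∈-concat⁻ (map st (allFin m)) B∈))

  ∈-upd⁻ : ∀ a f st i {B} → B ∈ upd a f st i → B ∈ f (st a) ⊎ B ∈ st i
  ∈-upd⁻ a f st i B∈ with i Fin.≟ a
  ... | yes refl = inj₁ B∈
  ... | no _ = inj₂ B∈

  upd-⊆ : ∀ a f st {S : List Bag} → f (st a) ⊆ S → (∀ j → st j ⊆ S) → ∀ i → upd a f st i ⊆ S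
  upd-⊆ a f st fa⊆S st⊆S i B∈ = [ fa⊆S , st⊆S i ]′ (∈-upd⁻ a f st i B∈)

  moveBag-⊆ : ∀ st a k c i → moveBag st a k c i ⊆ allBags st
  moveBag-⊆ st a k c = upd-⊆ c (lookup (st a) k ∷_) (upd a removed st) moved⊆ removed⊆
    where
    removed : List Bag → List Bag
    removed _ = removeAt (st a) k
    removed⊆ : ∀ j → upd a removed st j ⊆ allBags st
    removed⊆ = upd-⊆ a removed st (∈-allBags⁺ st a ∘ removeAt-⊆ (st a) k) (∈-allBags⁺ st)
    moved⊆ : lookup (st a) k ∷ upd a removed st c ⊆ allBags st
    moved⊆ (here refl) = ∈-allBags⁺ st a (∈-lookup k)
    moved⊆ (there B∈) = removed⊆ c B∈

  Rebalance-bags : ∀ {st st′} (R : Rebalance st st′) {B} →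
                   B ∈ allBags st′ → B ∈ Rebalance.new R ⊎ B ∈ allBags st
  Rebalance-bags {st} {st′} R B∈ with ∈-allBags⁻ st′ B∈
  ... | i , B∈i = Sum.map₂ (moveBag-⊆ st a k c i)
                    (∈-upd⁻ c (λ _ → new) (moveBag st a k c) i (subst (_ ∈_) (result i) B∈i))
    where open Rebalance R

  module UnitJobs (unit : ∀ j → p j ≡ 1ℚ) where

    pB≡fromℕ-length : ∀ B → pB B ≡ fromℕ (length B)
    pB≡fromℕ-length [] = refl
    pB≡fromℕ-length (j ∷ B) = cong₂ ℚ._+_ (unit j) (pB≡fromℕ-length B)

    pB-≤⇒length-≤ : ∀ B B′ → pB B ≤ pB B′ → length B ≤ℕ length B′
    pB-≤⇒length-≤ B B′ = fromℕ-cancel-≤ ∘ subst₂ _≤_ (pB≡fromℕ-length B) (pB≡fromℕ-length B′)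

    length-≤⇒pB-≤ : ∀ B B′ → length B ≤ℕ length B′ → pB B ≤ pB B′
    length-≤⇒pB-≤ B B′ = subst₂ _≤_ (sym (pB≡fromℕ-length B)) (sym (pB≡fromℕ-length B′)) ∘ fromℕ-mono-≤

    LPTAssign-Balanced : ∀ {js bs out} → LPTAssign js bs out → Balanced bs → Balanced out
    LPTAssign-Balanced done bal = bal
    LPTAssign-Balanced (step {j} {bs = bs} k least rest) bal =
      LPTAssign-Balanced rest (Balanced-%=-shortest k j bal shortest)
      where
      shortest : ∀ k′ → length (lookup bs k) ≤ℕ length (lookup bs k′)
      shortest k′ = pB-≤⇒length-≤ (lookup bs k) (lookup bs k′) (least k′)

    LPT-length≥ : ∀ {J ℓ out} t → LPT J ℓ out → ℓ ℕ.* t ≤ℕ length J → ∀ {B} → B ∈ out → t ≤ℕ length B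
    LPT-length≥ {J} {ℓ} {out} t (js , js↭J , _ , assign) ℓt≤J =
      Balanced⇒length≥ t (LPTAssign-Balanced assign (Balanced-replicate-[] ℓ)) enough
      where
      open ℕ.≤-Reasoning
      enough : length out ℕ.* t ≤ℕ sum (map length out)
      enough = begin
        length out ℕ.* t                ≡⟨ cong (ℕ._* t) (trans (LPTAssign-length assign) (length-replicate ℓ)) ⟩
        ℓ ℕ.* t                         ≤⟨ ℓt≤J ⟩
        length J                        ≡⟨ ↭-length js↭J ⟨
        length js                       ≤⟨ ℕ.m≤m+n (length js) _ ⟩
        length js ℕ.+ sum (map length (replicate ℓ []))  ≡⟨ LPTAssign-sum assign ⟨
        sum (map length out)            ∎

    Rebalance-minBag-mono : ∀ {st st′ b b′} → Rebalance st st′ →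
                            IsMinBag st b → IsMinBag st′ b′ → pB b ≤ pB b′
    Rebalance-minBag-mono {st} {b = b} {b′} R (_ , b-min) (b′∈ , _) =
      length-≤⇒pB-≤ b b′ ([ LPT-length≥ (length b) lpt enough , longer-than-b ]′ (Rebalance-bags R b′∈))
      where
      open Rebalance R
      longer-than-b : ∀ {B} → B ∈ allBags st → length b ≤ℕ length B
      longer-than-b {B} B∈ = pB-≤⇒length-≤ b B (All.lookup b-min B∈)
      L : List Bag
      L = moveBag st a k c c
      enough : length L ℕ.* length b ≤ℕ length (concat L)
      enough = subst (length L ℕ.* length b ≤ℕ_) (sym (length-concat L))
                 (length*≤sum-map length (length b) L (longer-than-b ∘ moveBag-⊆ st a k c c))

lemma10 : (n m : ℕ) (p : Fin n → ℚ) (ŝ : Fin m → ℚ) (ŝpos : ∀ i → Positive (ŝ i))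
    (ŝsorted : ∀ i j → i ≤F j → ŝ j ≤ ŝ i)
    (unit : ∀ j → p j ≡ 1ℚ)
    (α ε : ℚ) → 0ℚ < α → α < 1ℚ → 0ℚ < ε → ε < 1ℚ →
    (B : Fin m → IPR.Bag p ŝ ŝpos) → IPR.ValidInitial p ŝ ŝpos ε B →
    ∀ i st st' →
    IPR.Run p ŝ ŝpos α (+ 2 / 1) B i st →
    IPR.Iter p ŝ ŝpos α (+ 2 / 1) (IPR.OPTC p ŝ ŝpos B) st st' →
    ∀ b b' → IPR.IsMinBag p ŝ ŝpos st b → IPR.IsMinBag p ŝ ŝpos st' b' →
    IPR.pB p ŝ ŝpos b ≤ IPR.pB p ŝ ŝpos b'
lemma10 _ _ p ŝ ŝpos _ unit _ _ _ _ _ _ _ _ _ _ _ _ (_ , rebalance , _) _ _ b-min b'-min =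
  UnitJobs.Rebalance-minBag-mono p ŝ ŝpos unit rebalance b-min b'-min
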